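{- For every integer $m>1$, $\chi_{cf}(G_m)\ge \chi_{um}(G_{\lfloor m/2\rfloor})$.
   Context: $G_m$ is the $m\times m$ grid graph: vertex set $\{0,\dots,m-1\}^2$, with $(x_1,y_1)$ and $(x_2,y_2)$ adjacent iff $|x_1-x_2|+|y_1-y_2|=1$. A path is a simple path (a single vertex counts). A unique-maximum coloring of a graph with $k$ colors is a map from vertices to $\{1,\dots,k\}$ such that on every path the maximum color occurs exactly once; $\chi_{um}$ is the minimum such $k$. A conflict-free coloring with $k$ colors is a map to $\{1,\dots,k\}$ such that on every path some color occurs exactly once; $\chi_{cf}$ is the minimum such $k$. -}

module Defs where

open import Data.Nat using (ℕ; zero; suc; _+_; _⊔_; _<_; _≤_; ∣_-_∣; _≟_)
open import Data.Fin using (Fin; toℕ)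
open import Data.Product using (_×_; _,_; ∃-syntax; proj₁; proj₂)
open import Data.List using (List; []; map; foldr; filter; length)
open import Data.List.Relation.Unary.Linked using (Linked)
open import Data.List.Relation.Unary.Unique.Propositional using (Unique)
open import Relation.Binary.PropositionalEquality using (_≡_; _≢_)
open import Relation.Nullary using (¬_)

Vertex : ℕ → Set
Vertex m = Fin m × Fin m

Adj : ∀ {m} → Vertex m → Vertex m → Set
Adj (x₁ , y₁) (x₂ , y₂) = ∣ toℕ x₁ - toℕ x₂ ∣ + ∣ toℕ y₁ - toℕ y₂ ∣ ≡ 1

record IsPath {m : ℕ} (p : List (Vertex m)) : Set where
  field
    nonempty : p ≢ []
    distinct : Unique p
    linked   : Linked Adj p

-- A coloring with k colors; color i : Fin k stands for colour i+1 ∈ {1,…,k}.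
Coloring : ℕ → ℕ → Set
Coloring m k = Vertex m → Fin k

colorsOn : ∀ {m k} → Coloring m k → List (Vertex m) → List ℕ
colorsOn c p = map (λ v → toℕ (c v)) p

occ : ℕ → List ℕ → ℕ
occ j xs = length (filter (_≟ j) xs)

maxL : List ℕ → ℕ
maxL = foldr _⊔_ 0

IsUMColoring : ∀ {m k} → Coloring m k → Set
IsUMColoring {m} c = ∀ (p : List (Vertex m)) → IsPath p →
  occ (maxL (colorsOn c p)) (colorsOn c p) ≡ 1

IsCFColoring : ∀ {m k} → Coloring m k → Set
IsCFColoring {m} {k} c = ∀ (p : List (Vertex m)) → IsPath p →
  ∃[ j ] (occ (toℕ {k} j) (colorsOn c p) ≡ 1)

HasUMColoring : ℕ → ℕ → Set
HasUMColoring m k = ∃[ c ] IsUMColoring {m} {k} c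

HasCFColoring : ℕ → ℕ → Set
HasCFColoring m k = ∃[ c ] IsCFColoring {m} {k} c

IsChiUM : ℕ → ℕ → Set
IsChiUM m χ = HasUMColoring m χ × (∀ k → k < χ → ¬ HasUMColoring m k)

IsChiCF : ℕ → ℕ → Set
IsChiCF m χ = HasCFColoring m χ × (∀ k → k < χ → ¬ HasCFColoring m k)

-- Each cell of G_⌊m/2⌋ is blown up to a 2×2 block of G_m, and a conflict-free colouring of G_m is
-- turned into a unique-maximum colouring of the cells, by induction on a finite set X of cells.
-- Let C be the connected component of some cell of X. The blow-up of a connected set of cells has a
-- Hamiltonian cycle: adding the cells one at a time, each new block is spliced into the cycle along
-- the side it shares with the cells already present. Dropping one vertex leaves a path through the
-- whole blow-up of C, so some colour j occurs on exactly one of its vertices, lying in the block of a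
-- cell v. Hence j does not occur on the blow-up of C − v at all, which is therefore conflict-free
-- coloured with one colour fewer. Colour C − v recursively with k − 1 colours and X − C with k
-- colours, and give v the largest colour: a path in X lies either inside C or outside it, and inside
-- C it either meets v, whose colour is then the unique maximum, or avoids v.

module Submission where

open import Defs

open import Data.Empty using (⊥-elim)
open import Data.Fin.Base using (toℕ; fromℕ<)
open import Data.Fin.Properties using (toℕ-injective; toℕ<n; toℕ-fromℕ<)
open import Data.List.Base
  using (List; []; _∷_; _++_; [_]; map; drop; filter; length; upTo; cartesianProduct)
open import Data.List.Properties
  using (++-assoc; map-∘; map-cong-local; filter-accept; filter-reject; filter-none; filter-notAll)
open import Data.List.Membership.Propositional using (_∈_; _∉_; find; lose)
open import Data.List.Membership.Propositional.Properties
  using (∈-++⁺ˡ; ∈-++⁺ʳ; ∈-++⁻; ∈-map⁺; ∈-map⁻; ∈-filter⁺; ∈-filter⁻;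
         ∈-cartesianProduct⁺; ∈-cartesianProduct⁻; ∈-upTo⁺; ∈-upTo⁻)
import Data.List.Membership.DecPropositional as DecMembership
open import Data.List.Relation.Binary.Permutation.Propositional
  using (_↭_; ↭-refl; ↭-sym; ↭-trans; ↭-prep; ↭⇒↭ₛ)
open import Data.List.Relation.Binary.Permutation.Propositional.Properties using (shift; ∈-resp-↭)
import Data.List.Relation.Binary.Permutation.Setoid.Properties as PermutationSetoid
open import Data.List.Relation.Unary.All as All using (All; []; _∷_)
import Data.List.Relation.Unary.All.Properties as All
open import Data.List.Relation.Unary.Any using (here; there; any?)
open import Data.List.Relation.Unary.Linked as Linked using (Linked; []; [-]; _∷_)
import Data.List.Relation.Unary.Linked.Properties as Linked
open import Data.List.Relation.Unary.Unique.Propositional using (Unique; []; _∷_)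
import Data.List.Relation.Unary.Unique.Propositional.Properties as Unique
open import Data.Nat.Base
  using (ℕ; zero; suc; pred; _+_; _*_; _⊔_; _≤_; _<_; z≤n; s≤s; ∣_-_∣; ⌊_/2⌋; parity; NonZero; >-nonZero)
open import Data.Nat.DivMod using (_/_; m%n<n; m<n⇒m%n≡m; m/n*n≤m)
open import Data.Nat.Induction using (<-wellFounded)
open import Data.Nat.Properties
  using (_≟_; _<?_; ∣n-n∣≡0; ∣-∣-comm; ∣m-n∣≡0⇒m≡n; suc-injective; pred-injective; 1+n≢0; n≮0; ≮⇒≥;
         ≤∧≢⇒<; <⇒≱; <⇒≤; <⇒≢; ≤-pred; ≤-<-trans; <-≤-trans; m≤n⇒m≤1+n; m<n⇒m<1+n; n<1+n;
         ⊔-lub; m≥n⇒m⊔n≡m; m≤n⇒m⊔n≡n; *-monoˡ-≤; module ≤-Reasoning)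
open import Data.Parity.Base using (Parity; 0ℙ; 1ℙ)
open import Data.Product.Base using (_×_; _,_; ∃; ∃₂; ∃-syntax; proj₁; proj₂)
open import Data.Product.Properties using (≡-dec)
open import Data.Sum.Base using (_⊎_; inj₁; inj₂)
open import Function.Base using (_∘_)
open import Induction.WellFounded using (Acc; acc)
open import Level using (Level; 0ℓ)
open import Relation.Binary.Core using (Rel)
open import Relation.Binary.Definitions using (DecidableEquality) renaming (Decidable to Decidable₂)
open import Relation.Binary.PropositionalEquality
  using (_≡_; _≢_; refl; sym; trans; cong; cong₂; subst; setoid; ≢-sym; module ≡-Reasoning)
open import Relation.Nullary using (¬_; Dec; yes; no; ¬?; _×-dec_)
open import Relation.Nullary.Decidable using (decidable-stable)
open import Relation.Unary using (Pred; Decidable; _⊆_)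

-- Splicing a list into a walk

module _ {a : Level} {A : Set a} where

  data Consecutive (x y : A) : List A → Set a where
    here  : ∀ {zs} → Consecutive x y (x ∷ y ∷ zs)
    there : ∀ {z zs} → Consecutive x y zs → Consecutive x y (z ∷ zs)

  private variable
    x y u v : A
    cs w zs : List A

  consecutive-++⁺ˡ : ∀ {l} r → Consecutive u v l → Consecutive u v (l ++ r)
  consecutive-++⁺ˡ r here      = here
  consecutive-++⁺ˡ r (there c) = there (consecutive-++⁺ˡ r c)

  consecutive-++⁺ʳ : ∀ l {r} → Consecutive u v r → Consecutive u v (l ++ r)
  consecutive-++⁺ʳ []      c = c
  consecutive-++⁺ʳ (_ ∷ l) c = there (consecutive-++⁺ʳ l c)

  splice : Consecutive x y w → List A → List A
  splice {x} {y} (here {zs}) cs = x ∷ cs ++ y ∷ zs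
  splice (there {z} c)       cs = z ∷ splice c cs

  splice-↭ : (c : Consecutive x y w) → splice c cs ↭ cs ++ w
  splice-↭ {x} {y} {cs = cs} (here {zs}) = ↭-sym (shift x cs (y ∷ zs))
  splice-↭ {cs = cs} (there {z} {zs} c) = ↭-trans (↭-prep z (splice-↭ c)) (↭-sym (shift z cs zs))

  drop-splice-↭ : (c : Consecutive x y w) → drop 1 (splice c cs) ↭ cs ++ drop 1 w
  drop-splice-↭ here      = ↭-refl
  drop-splice-↭ (there c) = splice-↭ c

  linked-join : ∀ {ℓ} {R : Rel A ℓ} l → Linked R (l ++ [ y ]) → Linked R (y ∷ zs) → Linked R (l ++ y ∷ zs)
  linked-join []           _        Ryzs = Ryzs
  linked-join (_ ∷ [])     (r ∷ _)  Ryzs = r ∷ Ryzs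
  linked-join (_ ∷ _ ∷ l)  (r ∷ rs) Ryzs = r ∷ linked-join (_ ∷ l) rs Ryzs

  splice-linked : ∀ {ℓ} {R : Rel A ℓ} (c : Consecutive x y w) →
    Linked R w → Linked R (x ∷ cs ++ [ y ]) → Linked R (splice c cs)
  splice-linked here              Rw       Rcs = linked-join (_ ∷ _) Rcs (Linked.tail Rw)
  splice-linked (there here)      (r ∷ Rw) Rcs = r ∷ splice-linked here Rw Rcs
  splice-linked (there (there c)) (r ∷ Rw) Rcs = r ∷ splice-linked (there c) Rw Rcs

  splice-keeps : Consecutive u v w → (u , v) ≢ (x , y) → (c : Consecutive x y w) →
    Consecutive u v (splice c cs)
  splice-keeps here      uv≢xy here              = ⊥-elim (uv≢xy refl)
  splice-keeps here      _     (there here)      = here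
  splice-keeps here      _     (there (there c)) = here
  splice-keeps {cs = cs} (there o) _ here        = there (consecutive-++⁺ʳ cs o)
  splice-keeps (there o) uv≢xy (there c)         = there (splice-keeps o uv≢xy c)

  splice-detour : Consecutive u v (x ∷ cs ++ [ y ]) → (c : Consecutive x y w) →
    Consecutive u v (splice c cs)
  splice-detour {x = x} {cs} {y} d (here {zs}) =
    subst (Consecutive _ _) (cong (x ∷_) (++-assoc cs [ y ] zs)) (consecutive-++⁺ˡ zs d)
  splice-detour d (there c) = there (splice-detour d c)

module _ {a p q : Level} {A : Set a} {P : Pred A p} {Q : Pred A q}
         (P? : Decidable P) (Q? : Decidable Q) (P⊆Q : P ⊆ Q) where

  length-filter-mono : ∀ xs → length (filter P? xs) ≤ length (filter Q? xs)
  length-filter-mono []       = z≤n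
  length-filter-mono (x ∷ xs) with P? x | Q? x
  ... | yes _  | yes _   = s≤s (length-filter-mono xs)
  ... | yes px | no ¬qx  = ⊥-elim (¬qx (P⊆Q px))
  ... | no _   | yes _   = m≤n⇒m≤1+n (length-filter-mono xs)
  ... | no _   | no _    = length-filter-mono xs

  length-filter-< : ∀ {x xs} → x ∈ xs → Q x → ¬ P x → length (filter P? xs) < length (filter Q? xs)
  length-filter-< {x} {_ ∷ xs} (here refl) qx ¬px with P? x | Q? x
  ... | yes px | _      = ⊥-elim (¬px px)
  ... | no _   | yes _  = s≤s (length-filter-mono xs)
  ... | no _   | no ¬qx = ⊥-elim (¬qx qx)
  length-filter-< {_} {y ∷ xs} (there x∈) qx ¬px with P? y | Q? y
  ... | yes _  | yes _   = s≤s (length-filter-< x∈ qx ¬px)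
  ... | yes py | no ¬qy  = ⊥-elim (¬qy (P⊆Q py))
  ... | no _   | yes _   = m≤n⇒m≤1+n (length-filter-< x∈ qx ¬px)
  ... | no _   | no _    = length-filter-< x∈ qx ¬px

module _ {a : Level} {A : Set a} where

  map-≢[] : ∀ {b} {B : Set b} {f : B → A} {xs} → xs ≢ [] → map f xs ≢ []
  map-≢[] {xs = []}    xs≢[] = ⊥-elim (xs≢[] refl)
  map-≢[] {xs = _ ∷ _} _     ()

  ∈⇒≢[] : ∀ {x : A} {xs} → x ∈ xs → xs ≢ []
  ∈⇒≢[] (here _)  ()
  ∈⇒≢[] (there _) ()

  linked-drop1 : ∀ {ℓ} {R : Rel A ℓ} {w} → Linked R w → Linked R (drop 1 w)
  linked-drop1 []       = []
  linked-drop1 [-]      = []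
  linked-drop1 (_ ∷ Rw) = Rw

  unique-resp-↭ : ∀ {xs ys : List A} → xs ↭ ys → Unique xs → Unique ys
  unique-resp-↭ p = PermutationSetoid.Unique-resp-↭ (setoid A) (↭⇒↭ₛ p)

Point : Set
Point = ℕ × ℕ

infix 4 _∼_
_∼_ : Point → Point → Set
(x₁ , y₁) ∼ (x₂ , y₂) = ∣ x₁ - x₂ ∣ + ∣ y₁ - y₂ ∣ ≡ 1

_∼?_ : Decidable₂ _∼_
(x₁ , y₁) ∼? (x₂ , y₂) = ∣ x₁ - x₂ ∣ + ∣ y₁ - y₂ ∣ ≟ 1

_≟ₚ_ : DecidableEquality Point
_≟ₚ_ = ≡-dec _≟_ _≟_

open DecMembership _≟ₚ_ using (_∈?_)

_∉?_ : (q : Point) (C : List Point) → Dec (q ∉ C)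
q ∉? C = ¬? (q ∈? C)

∼-sym : ∀ {p q} → p ∼ q → q ∼ p
∼-sym {x₁ , y₁} {x₂ , y₂} p∼q rewrite ∣-∣-comm x₂ x₁ | ∣-∣-comm y₂ y₁ = p∼q

∣n-1+n∣≡1 : ∀ n → ∣ n - suc n ∣ ≡ 1
∣n-1+n∣≡1 zero    = refl
∣n-1+n∣≡1 (suc n) = ∣n-1+n∣≡1 n

∣m-n∣≡1⇒n≡1+m⊎m≡1+n : ∀ m n → ∣ m - n ∣ ≡ 1 → n ≡ suc m ⊎ m ≡ suc n
∣m-n∣≡1⇒n≡1+m⊎m≡1+n zero    (suc zero) refl = inj₁ refl
∣m-n∣≡1⇒n≡1+m⊎m≡1+n (suc zero) zero    refl = inj₂ refl
∣m-n∣≡1⇒n≡1+m⊎m≡1+n (suc m) (suc n) eq with ∣m-n∣≡1⇒n≡1+m⊎m≡1+n m n eq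
... | inj₁ e = inj₁ (cong suc e)
... | inj₂ e = inj₂ (cong suc e)

∼-east : ∀ x y → (x , y) ∼ (suc x , y)
∼-east x y rewrite ∣n-1+n∣≡1 x | ∣n-n∣≡0 y = refl

∼-north : ∀ x y → (x , y) ∼ (x , suc y)
∼-north x y rewrite ∣n-n∣≡0 x | ∣n-1+n∣≡1 y = refl

∼-west : ∀ x y → (suc x , y) ∼ (x , y)
∼-west x y = ∼-sym {x , y} (∼-east x y)

∼-south : ∀ x y → (x , suc y) ∼ (x , y)
∼-south x y = ∼-sym {x , y} (∼-north x y)

data Dir : Set where
  east north west south : Dir

ccw cw opp : Dir → Dir
ccw east  = north
ccw north = west
ccw west  = south
ccw south = east

cw east  = south
cw north = east
cw west  = north
cw south = west

opp d = ccw (ccw d)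

ccw-cw : ∀ d → ccw (cw d) ≡ d
ccw-cw east  = refl
ccw-cw north = refl
ccw-cw west  = refl
ccw-cw south = refl

data Neighbour : Dir → Point → Point → Set where
  east  : ∀ {a b} → Neighbour east  (a , b) (suc a , b)
  north : ∀ {a b} → Neighbour north (a , b) (a , suc b)
  west  : ∀ {a b} → Neighbour west  (suc a , b) (a , b)
  south : ∀ {a b} → Neighbour south (a , suc b) (a , b)

neighbour-functional : ∀ {d p q q′} → Neighbour d p q → Neighbour d p q′ → q ≡ q′
neighbour-functional east  east  = refl
neighbour-functional north north = refl
neighbour-functional west  west  = refl
neighbour-functional south south = refl

neighbour-opp : ∀ {d p q} → Neighbour d p q → Neighbour (opp d) q p
neighbour-opp east  = west
neighbour-opp north = south
neighbour-opp west  = east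
neighbour-opp south = north

∼⇒neighbour : ∀ {p q} → p ∼ q → ∃ λ d → Neighbour d p q
∼⇒neighbour {a , b} {c , d} p∼q with ∣ a - c ∣ in ea | ∣ b - d ∣ in eb
∼⇒neighbour {a , b} {c , d} refl | zero | suc zero with ∣m-n∣≡0⇒m≡n {a} {c} ea | ∣m-n∣≡1⇒n≡1+m⊎m≡1+n b d eb
... | refl | inj₁ refl = north , north
... | refl | inj₂ refl = south , south
∼⇒neighbour {a , b} {c , d} refl | suc zero | zero with ∣m-n∣≡1⇒n≡1+m⊎m≡1+n a c ea | ∣m-n∣≡0⇒m≡n {b} {d} eb
... | inj₁ refl | refl = east , east
... | inj₂ refl | refl = west , west

double : ℕ → ℕ
double zero    = zero
double (suc n) = suc (suc (double n))

block : Point → Point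
block (x , y) = ⌊ x /2⌋ , ⌊ y /2⌋

-- The corner of block p at which side d of the block starts, going counterclockwise.
corner : Dir → Point → Point
corner east  (a , b) = suc (double a) , double b
corner north (a , b) = suc (double a) , suc (double b)
corner west  (a , b) = double a , suc (double b)
corner south (a , b) = double a , double b

⌊double/2⌋ : ∀ n → ⌊ double n /2⌋ ≡ n
⌊double/2⌋ zero    = refl
⌊double/2⌋ (suc n) = cong suc (⌊double/2⌋ n)

⌊1+double/2⌋ : ∀ n → ⌊ suc (double n) /2⌋ ≡ n
⌊1+double/2⌋ zero    = refl
⌊1+double/2⌋ (suc n) = cong suc (⌊1+double/2⌋ n)

parity-double : ∀ n → parity (double n) ≡ 0ℙ
parity-double zero    = refl
parity-double (suc n) = parity-double n

parity-1+double : ∀ n → parity (suc (double n)) ≡ 1ℙ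
parity-1+double zero    = refl
parity-1+double (suc n) = parity-1+double n

block-corner : ∀ d p → block (corner d p) ≡ p
block-corner east  (a , b) = cong₂ _,_ (⌊1+double/2⌋ a) (⌊double/2⌋ b)
block-corner north (a , b) = cong₂ _,_ (⌊1+double/2⌋ a) (⌊1+double/2⌋ b)
block-corner west  (a , b) = cong₂ _,_ (⌊double/2⌋ a) (⌊1+double/2⌋ b)
block-corner south (a , b) = cong₂ _,_ (⌊double/2⌋ a) (⌊double/2⌋ b)

cornerDir : Point → Dir
cornerDir (x , y) = dir (parity x) (parity y)
  where
  dir : Parity → Parity → Dir
  dir 1ℙ 0ℙ = east
  dir 1ℙ 1ℙ = north
  dir 0ℙ 1ℙ = west
  dir 0ℙ 0ℙ = south

cornerDir-corner : ∀ d p → cornerDir (corner d p) ≡ d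
cornerDir-corner east  (a , b) rewrite parity-1+double a | parity-double b   = refl
cornerDir-corner north (a , b) rewrite parity-1+double a | parity-1+double b = refl
cornerDir-corner west  (a , b) rewrite parity-double a   | parity-1+double b = refl
cornerDir-corner south (a , b) rewrite parity-double a   | parity-double b   = refl

corner-injective : ∀ {d d′ p p′} → corner d p ≡ corner d′ p′ → d ≡ d′ × p ≡ p′
corner-injective {d} {d′} {p} {p′} e =
  trans (sym (cornerDir-corner d p)) (trans (cong cornerDir e) (cornerDir-corner d′ p′)) ,
  trans (sym (block-corner d p)) (trans (cong block e) (block-corner d′ p′))

data Halves : ℕ → Set where
  even : ∀ a → Halves (double a)
  odd  : ∀ a → Halves (suc (double a))

halves : ∀ n → Halves n
halves zero          = even zero
halves (suc zero)    = odd zero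
halves (suc (suc n)) with halves n
... | even a = even (suc a)
... | odd a  = odd (suc a)

corner-surjective : ∀ q → ∃₂ λ d p → corner d p ≡ q
corner-surjective (x , y) with halves x | halves y
... | even a | even b = south , (a , b) , refl
... | odd a  | even b = east  , (a , b) , refl
... | odd a  | odd b  = north , (a , b) , refl
... | even a | odd b  = west  , (a , b) , refl

block≡⇒corner : ∀ {q u} → block q ≡ u → ∃ λ d → corner d u ≡ q
block≡⇒corner {q} refl with corner-surjective q
... | d , p , refl = d , cong (corner d) (block-corner d p)

corner-∼-ccw : ∀ d p → corner d p ∼ corner (ccw d) p
corner-∼-ccw east  (a , b) = ∼-north (suc (double a)) (double b)
corner-∼-ccw north (a , b) = ∼-west (double a) (suc (double b))
corner-∼-ccw west  (a , b) = ∼-south (double a) (double b)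
corner-∼-ccw south (a , b) = ∼-east (double a) (double b)

neighbour-∼-cw : ∀ {d p q} → Neighbour d p q → corner d p ∼ corner (cw d) q
neighbour-∼-cw {p = a , b} east  = ∼-east (suc (double a)) (double b)
neighbour-∼-cw {p = a , b} north = ∼-north (suc (double a)) (suc (double b))
neighbour-∼-cw {q = a , b} west  = ∼-west (suc (double a)) (suc (double b))
neighbour-∼-cw {q = a , b} south = ∼-south (double a) (suc (double b))

neighbour-∼-opp : ∀ {d p q} → Neighbour d p q → corner (opp d) q ∼ corner (ccw d) p
neighbour-∼-opp {p = a , b} east  = ∼-west (suc (double a)) (suc (double b))
neighbour-∼-opp {p = a , b} north = ∼-south (double a) (suc (double b))
neighbour-∼-opp {q = a , b} west  = ∼-east (suc (double a)) (double b)
neighbour-∼-opp {q = a , b} south = ∼-north (suc (double a)) (suc (double b))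

around : Dir → List Dir
around d = cw d ∷ d ∷ ccw d ∷ opp d ∷ []

around-unique : ∀ d → Unique (around d)
around-unique east  = ((λ ()) ∷ (λ ()) ∷ (λ ()) ∷ []) ∷ ((λ ()) ∷ (λ ()) ∷ []) ∷ ((λ ()) ∷ []) ∷ [] ∷ []
around-unique north = ((λ ()) ∷ (λ ()) ∷ (λ ()) ∷ []) ∷ ((λ ()) ∷ (λ ()) ∷ []) ∷ ((λ ()) ∷ []) ∷ [] ∷ []
around-unique west  = ((λ ()) ∷ (λ ()) ∷ (λ ()) ∷ []) ∷ ((λ ()) ∷ (λ ()) ∷ []) ∷ ((λ ()) ∷ []) ∷ [] ∷ []
around-unique south = ((λ ()) ∷ (λ ()) ∷ (λ ()) ∷ []) ∷ ((λ ()) ∷ (λ ()) ∷ []) ∷ ((λ ()) ∷ []) ∷ [] ∷ []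

∈-around : ∀ d e → e ∈ around d
∈-around east  south = here refl
∈-around east  east  = there (here refl)
∈-around east  north = there (there (here refl))
∈-around east  west  = there (there (there (here refl)))
∈-around north east  = here refl
∈-around north north = there (here refl)
∈-around north west  = there (there (here refl))
∈-around north south = there (there (there (here refl)))
∈-around west  north = here refl
∈-around west  west  = there (here refl)
∈-around west  south = there (there (here refl))
∈-around west  east  = there (there (there (here refl)))
∈-around south west  = here refl
∈-around south south = there (here refl)
∈-around south east  = there (there (here refl))
∈-around south north = there (there (there (here refl)))

-- Hamiltonian tours of blown-up cells

-- A closed walk w around the blow-up of the cells C: its tail visits every point of the blow-up
-- exactly once, and w runs counterclockwise along each side of the blow-up's boundary.
record Tour (C w : List Point) : Set where
  field
    linked   : Linked _∼_ w
    unique   : Unique (drop 1 w)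
    sound    : ∀ {q} → q ∈ drop 1 w → block q ∈ C
    complete : ∀ {q} → block q ∈ C → q ∈ drop 1 w
    sides    : ∀ {d p q} → Neighbour d p q → p ∈ C → q ∉ C →
               Consecutive (corner d p) (corner (ccw d) p) w

detour : Dir → Point → List Point
detour d u = map (λ e → corner e u) (around d)

detour-unique : ∀ d u → Unique (detour d u)
detour-unique d u = Unique.map⁺ (λ e → proj₁ (corner-injective e)) (around-unique d)

block≡⇒∈detour : ∀ d {u q} → block q ≡ u → q ∈ detour d u
block≡⇒∈detour d bq≡u with block≡⇒corner bq≡u
... | e , refl = ∈-map⁺ (λ e → corner e _) (∈-around d e)

∈detour⇒block≡ : ∀ {d u q} → q ∈ detour d u → block q ≡ u
∈detour⇒block≡ {u = u} q∈ with ∈-map⁻ (λ e → corner e u) q∈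
... | e , _ , refl = block-corner e u

detour-linked : ∀ {d p u} → Neighbour d p u → Linked _∼_ (corner d p ∷ detour d u ++ [ corner (ccw d) p ])
detour-linked {d} {u = u} nb =
  neighbour-∼-cw nb ∷ subst (λ e → corner (cw d) u ∼ corner e u) (ccw-cw d) (corner-∼-ccw (cw d) u) ∷
  corner-∼-ccw d u ∷ corner-∼-ccw (ccw d) u ∷ neighbour-∼-opp nb ∷ [-]

detour-sides : ∀ {d p u e} → Neighbour d p u → e ≢ opp d →
  Consecutive (corner e u) (corner (ccw e) u) (corner d p ∷ detour d u ++ [ corner (ccw d) p ])
detour-sides {d} {p} {u} {e} nb e≢opp with ∈-around d e
... | here refl = there (subst (λ e′ → Consecutive (corner (cw d) u) (corner e′ u) (detour d u ++ [ corner (ccw d) p ]))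
                               (sym (ccw-cw d)) here)
... | there (here refl) = there (there here)
... | there (there (here refl)) = there (there (there here))
... | there (there (there (here refl))) = ⊥-elim (e≢opp refl)

-- The detour runs counterclockwise round the new block u, so that the three free sides of u are
-- again traversed counterclockwise.
module _ {C w : List Point} {d : Dir} {p u : Point} (t : Tour C w)
         (nb : Neighbour d p u) (p∈C : p ∈ C) (u∉C : u ∉ C) where

  open Tour t

  private
    side : Consecutive (corner d p) (corner (ccw d) p) w
    side = sides nb p∈C u∉C

    ↭-detour : drop 1 (splice side (detour d u)) ↭ detour d u ++ drop 1 w
    ↭-detour = drop-splice-↭ side

    disjoint : ∀ {q} → ¬ (q ∈ detour d u × q ∈ drop 1 w)
    disjoint (q∈d , q∈w) = u∉C (subst (_∈ C) (∈detour⇒block≡ q∈d) (sound q∈w))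

  tour-extend : Tour (u ∷ C) (splice side (detour d u))
  tour-extend = record
    { linked   = splice-linked side linked (detour-linked nb)
    ; unique   = unique-resp-↭ (↭-sym ↭-detour) (Unique.++⁺ (detour-unique d u) unique disjoint)
    ; sound    = sound′
    ; complete = complete′
    ; sides    = sides′
    }
    where
    sound′ : ∀ {q} → q ∈ drop 1 (splice side (detour d u)) → block q ∈ u ∷ C
    sound′ q∈ with ∈-++⁻ (detour d u) (∈-resp-↭ ↭-detour q∈)
    ... | inj₁ q∈d = here (∈detour⇒block≡ q∈d)
    ... | inj₂ q∈w = there (sound q∈w)

    complete′ : ∀ {q} → block q ∈ u ∷ C → q ∈ drop 1 (splice side (detour d u))
    complete′ (here bq≡u)  = ∈-resp-↭ (↭-sym ↭-detour) (∈-++⁺ˡ (block≡⇒∈detour d bq≡u))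
    complete′ (there bq∈C) = ∈-resp-↭ (↭-sym ↭-detour) (∈-++⁺ʳ (detour d u) (complete bq∈C))

    sides′ : ∀ {d′ p′ q′} → Neighbour d′ p′ q′ → p′ ∈ u ∷ C → q′ ∉ u ∷ C →
             Consecutive (corner d′ p′) (corner (ccw d′) p′) (splice side (detour d u))
    sides′ nb′ (here refl) q′∉ = splice-detour (detour-sides nb facing-p) side
      where
      facing-p : _ ≢ opp d
      facing-p refl = q′∉ (there (subst (_∈ C) (neighbour-functional (neighbour-opp nb) nb′) p∈C))
    sides′ {d′} {p′} nb′ (there p′∈C) q′∉ = splice-keeps (sides nb′ p′∈C (λ q′∈C → q′∉ (there q′∈C))) other-side side
      where
      other-side : (corner d′ p′ , corner (ccw d′) p′) ≢ (corner d p , corner (ccw d) p)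
      other-side e with corner-injective (cong proj₁ e)
      ... | refl , refl = q′∉ (here (neighbour-functional nb′ nb))

tour-single : ∀ v → Tour [ v ] (corner south v ∷ detour north v)
tour-single v = record
  { linked   = corner-∼-ccw south v ∷ corner-∼-ccw east v ∷ corner-∼-ccw north v ∷ corner-∼-ccw west v ∷ [-]
  ; unique   = detour-unique north v
  ; sound    = λ q∈ → here (∈detour⇒block≡ {north} q∈)
  ; complete = λ { (here bq≡v) → block≡⇒∈detour north bq≡v ; (there ()) }
  ; sides    = λ { {d} _ (here refl) _ → side d ; _ (there ()) _ }
  }
  where
  side : ∀ d → Consecutive (corner d v) (corner (ccw d) v) (corner south v ∷ detour north v)
  side south = here
  side east  = there here
  side north = there (there here)
  side west  = there (there (there here))

-- Connected components

Closed : List Point → List Point → Set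
Closed X C = ∀ {p q} → p ∈ C → q ∈ X → p ∼ q → q ∈ C

record Component (X : List Point) (v : Point) : Set where
  field
    cells  : List Point
    walk   : List Point
    tour   : Tour cells walk
    ⊆X     : ∀ {q} → q ∈ cells → q ∈ X
    ∋v     : v ∈ cells
    closed : Closed X cells

module _ {X : List Point} {v : Point} where

  private
    outside : List Point → List Point
    outside C = filter (_∉? C) X

  component-from : ∀ C {w} → Acc _<_ (length (outside C)) → Tour C w →
    (∀ {q} → q ∈ C → q ∈ X) → v ∈ C → Component X v
  component-from C (acc rs) t C⊆X v∈C
    with any? (λ (p , q) → (p ∼? q) ×-dec (q ∉? C)) (cartesianProduct C X)
  ... | yes found with find found
  ... | (p , u) , pu∈ , p∼u , u∉C with ∈-cartesianProduct⁻ C X pu∈ | ∼⇒neighbour p∼u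
  ... | p∈C , u∈X | d , nb =
    component-from (u ∷ C) (rs shrinks) (tour-extend t nb p∈C u∉C) C′⊆X (there v∈C)
    where
    shrinks : length (outside (u ∷ C)) < length (outside C)
    shrinks = length-filter-< (_∉? (u ∷ C)) (_∉? C) (λ q∉uC q∈C → q∉uC (there q∈C))
                              u∈X u∉C (λ u∉uC → u∉uC (here refl))
    C′⊆X : ∀ {q} → q ∈ u ∷ C → q ∈ X
    C′⊆X (here refl) = u∈X
    C′⊆X (there q∈C) = C⊆X q∈C
  component-from C {w} _ t C⊆X v∈C | no none = record
    { cells = C ; walk = w ; tour = t ; ⊆X = C⊆X ; ∋v = v∈C
    ; closed = λ {p} {q} p∈C q∈X p∼q →
        decidable-stable (q ∈? C) (λ q∉C → none (lose (∈-cartesianProduct⁺ p∈C q∈X) (p∼q , q∉C)))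
    }

  component : v ∈ X → Component X v
  component v∈X = component-from [ v ] (<-wellFounded _) (tour-single v) single⊆X (here refl)
    where
    single⊆X : ∀ {q} → q ∈ [ v ] → q ∈ X
    single⊆X (here refl) = v∈X

private variable
  j x : ℕ
  xs : List ℕ

occ-here : ∀ xs → x ≡ j → occ j (x ∷ xs) ≡ suc (occ j xs)
occ-here {j = j} xs x≡j = cong length (filter-accept (_≟ j) x≡j)

occ-there : ∀ xs → x ≢ j → occ j (x ∷ xs) ≡ occ j xs
occ-there {j = j} xs x≢j = cong length (filter-reject (_≟ j) x≢j)

occ-none : All (_≢ j) xs → occ j xs ≡ 0
occ-none {j} none = cong length (filter-none (_≟ j) none)

occ≡0⇒∉ : ∀ xs → occ j xs ≡ 0 → j ∉ xs
occ≡0⇒∉ (x ∷ xs) o (here refl) = 1+n≢0 (trans (sym (occ-here {x = x} xs refl)) o)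
occ≡0⇒∉ {j} (x ∷ xs) o (there j∈) with x ≟ j
... | yes x≡j = 1+n≢0 (trans (sym (occ-here xs x≡j)) o)
... | no x≢j  = occ≡0⇒∉ xs (trans (sym (occ-there xs x≢j)) o) j∈

occ≢0⇒∈ : ∀ xs → occ j xs ≢ 0 → j ∈ xs
occ≢0⇒∈ [] o = ⊥-elim (o refl)
occ≢0⇒∈ {j} (x ∷ xs) o with x ≟ j
... | yes refl = here refl
... | no x≢j   = there (occ≢0⇒∈ xs (λ e → o (trans (occ-there xs x≢j) e)))

occ≡1-unique : ∀ {A : Set} (f : A → ℕ) l {a b} → occ j (map f l) ≡ 1 →
  a ∈ l → b ∈ l → f a ≡ j → f b ≡ j → a ≡ b
occ≡1-unique {j} f (x ∷ l) {a} {b} o a∈ b∈ fa fb with f x ≟ j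
... | yes fx≡j = both-x a∈ b∈
  where
  j∉l : ∀ {c} → c ∈ l → f c ≢ j
  j∉l c∈ fc≡j = occ≡0⇒∉ (map f l) (suc-injective (trans (sym (occ-here (map f l) fx≡j)) o))
                          (subst (_∈ map f l) fc≡j (∈-map⁺ f c∈))
  both-x : a ∈ x ∷ l → b ∈ x ∷ l → a ≡ b
  both-x (here refl) (here refl) = refl
  both-x (here _)    (there b∈l) = ⊥-elim (j∉l b∈l fb)
  both-x (there a∈l) _           = ⊥-elim (j∉l a∈l fa)
... | no fx≢j = neither-x a∈ b∈
  where
  neither-x : a ∈ x ∷ l → b ∈ x ∷ l → a ≡ b
  neither-x (here refl)  _            = ⊥-elim (fx≢j fa)
  neither-x (there _)    (here refl)  = ⊥-elim (fx≢j fb)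
  neither-x (there a∈l) (there b∈l) =
    occ≡1-unique f l (trans (sym (occ-there (map f l) fx≢j)) o) a∈l b∈l fa fb

occ-map : ∀ (f : ℕ → ℕ) {a} xs → (∀ {x} → x ∈ xs → f x ≡ f a → x ≡ a) →
  occ (f a) (map f xs) ≡ occ a xs
occ-map f []       _   = refl
occ-map f {a} (x ∷ xs) inj with x ≟ a
... | yes x≡a = begin
  occ (f a) (f x ∷ map f xs) ≡⟨ occ-here (map f xs) (cong f x≡a) ⟩
  suc (occ (f a) (map f xs)) ≡⟨ cong suc (occ-map f xs (inj ∘ there)) ⟩
  suc (occ a xs)             ≡⟨ occ-here xs x≡a ⟨
  occ a (x ∷ xs)             ∎
  where open ≡-Reasoning
... | no x≢a = begin
  occ (f a) (f x ∷ map f xs) ≡⟨ occ-there (map f xs) (x≢a ∘ inj (here refl)) ⟩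
  occ (f a) (map f xs)       ≡⟨ occ-map f xs (inj ∘ there) ⟩
  occ a xs                   ≡⟨ occ-there xs x≢a ⟨
  occ a (x ∷ xs)             ∎
  where open ≡-Reasoning

maxL-least : ∀ {m} → All (_≤ m) xs → maxL xs ≤ m
maxL-least []       = z≤n
maxL-least (h ∷ hs) = ⊔-lub h (maxL-least hs)

module _ {A : Set} (r : A → ℕ) {v : A} where

  private
    top : ∀ l → Unique l → v ∈ l → (∀ {q} → q ∈ l → q ≢ v → r q < r v) →
          maxL (map r l) ≡ r v × occ (r v) (map r l) ≡ 1
    top (x ∷ l) (x∉l ∷ _) (here refl) below =
      m≥n⇒m⊔n≡m (maxL-least (All.map⁺ (All.map <⇒≤ rest<))) ,
      trans (occ-here (map r l) refl) (cong suc (occ-none (All.map⁺ (All.map <⇒≢ rest<))))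
      where
      rest< : All (λ q → r q < r x) l
      rest< = All.tabulate (λ q∈ → below (there q∈) (≢-sym (All.lookup x∉l q∈)))
    top (x ∷ l) (x∉l ∷ ul) (there v∈) below with top l ul v∈ (below ∘ there)
    ... | max≡ , occ≡ =
      trans (cong (r x ⊔_) max≡) (m≤n⇒m⊔n≡n (<⇒≤ rx<rv)) ,
      trans (occ-there (map r l) (<⇒≢ rx<rv)) occ≡
      where
      rx<rv : r x < r v
      rx<rv = below (here refl) (All.lookup x∉l v∈)

  unique-maximum : ∀ l → Unique l → v ∈ l → (∀ {q} → q ∈ l → q ≢ v → r q < r v) →
    occ (maxL (map r l)) (map r l) ≡ 1
  unique-maximum l ul v∈ below with top l ul v∈ below
  ... | max≡ , occ≡ = subst (λ m → occ m (map r l) ≡ 1) (sym max≡) occ≡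

punchOut : ℕ → ℕ → ℕ
punchOut j x with x <? j
... | yes _ = x
... | no _  = pred x

private
  above : ∀ {x j} → x ≢ j → ¬ x < j → j < x
  above x≢j x≮j = ≤∧≢⇒< (≮⇒≥ x≮j) (≢-sym x≢j)

  ≤-pred-of : ∀ {x j} → j < x → j ≤ pred x
  ≤-pred-of {suc x} j<x = ≤-pred j<x

punchOut-injective : ∀ {j x y} → x ≢ j → y ≢ j → punchOut j x ≡ punchOut j y → x ≡ y
punchOut-injective {j} {x} {y} x≢j y≢j e with x <? j | y <? j
... | yes _   | yes _   = e
... | yes x<j | no y≮j  = ⊥-elim (<⇒≱ x<j (subst (j ≤_) (sym e) (≤-pred-of (above y≢j y≮j))))
... | no x≮j  | yes y<j = ⊥-elim (<⇒≱ y<j (subst (j ≤_) e (≤-pred-of (above x≢j x≮j))))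
... | no x≮j  | no y≮j  =
  pred-injective {{>-nonZero (≤-<-trans z≤n (above x≢j x≮j))}} {{>-nonZero (≤-<-trans z≤n (above y≢j y≮j))}} e

punchOut-< : ∀ {j x k} → x ≢ j → x < suc k → j < suc k → punchOut j x < k
punchOut-< {j} {x} x≢j x<1+k j<1+k with x <? j
... | yes x<j = <-≤-trans x<j (≤-pred j<1+k)
... | no x≮j  = pred-< (above x≢j x≮j) x<1+k
  where
  pred-< : ∀ {x k} → j < x → x < suc k → pred x < k
  pred-< {suc x} _ x<1+k = ≤-pred x<1+k

-- Conflict-free and unique-maximum colourings

record GridPath (p : List Point) : Set where
  field
    nonempty : p ≢ []
    distinct : Unique p
    linked   : Linked _∼_ p

record ConflictFree (k : ℕ) (c : Point → ℕ) (S : Pred Point 0ℓ) : Set where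
  field
    bounded       : ∀ {q} → S q → c q < k
    conflict-free : ∀ {p} → GridPath p → All S p → ∃[ j ] occ j (map c p) ≡ 1

record UniqueMaximum (k : ℕ) (r : Point → ℕ) (S : Pred Point 0ℓ) : Set where
  field
    bounded    : ∀ {q} → S q → r q < k
    unique-max : ∀ {p} → GridPath p → All S p → occ (maxL (map r p)) (map r p) ≡ 1

BlowUp : List Point → Pred Point 0ℓ
BlowUp X q = block q ∈ X

private variable
  k : ℕ
  S S′ : Pred Point 0ℓ

conflictFree-⊆ : ∀ {c} → S′ ⊆ S → ConflictFree k c S → ConflictFree k c S′
conflictFree-⊆ S′⊆S cf = record
  { bounded       = bounded ∘ S′⊆S
  ; conflict-free = λ path Sp → conflict-free path (All.map S′⊆S Sp)
  }
  where open ConflictFree cf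

uniqueMaximum-⊆ : ∀ {r} → S′ ⊆ S → UniqueMaximum k r S → UniqueMaximum k r S′
uniqueMaximum-⊆ S′⊆S um = record
  { bounded    = bounded ∘ S′⊆S
  ; unique-max = λ path Sp → unique-max path (All.map S′⊆S Sp)
  }
  where open UniqueMaximum um

conflictFree-punchOut : ∀ {c j} → (∀ {q} → S q → c q ≢ j) → j < suc k →
  ConflictFree (suc k) c S → ConflictFree k (punchOut j ∘ c) S
conflictFree-punchOut {S = S} {c = c} {j = j} avoid j<1+k cf = record
  { bounded       = λ Sq → punchOut-< (avoid Sq) (bounded Sq) j<1+k
  ; conflict-free = conflict-free′
  }
  where
  open ConflictFree cf
  conflict-free′ : ∀ {p} → GridPath p → All S p → ∃[ i ] occ i (map (punchOut j ∘ c) p) ≡ 1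
  conflict-free′ {p} path Sp with conflict-free path Sp
  ... | i , occ≡1 = punchOut j i , (begin
    occ (punchOut j i) (map (punchOut j ∘ c) p)     ≡⟨ cong (occ (punchOut j i)) (map-∘ p) ⟩
    occ (punchOut j i) (map (punchOut j) (map c p)) ≡⟨ occ-map (punchOut j) (map c p) injective ⟩
    occ i (map c p)                                 ≡⟨ occ≡1 ⟩
    1                                               ∎)
    where
    open ≡-Reasoning
    colour≢j : ∀ {x} → x ∈ map c p → x ≢ j
    colour≢j x∈ with ∈-map⁻ c x∈
    ... | q , q∈p , refl = avoid (All.lookup Sp q∈p)
    i∈ : i ∈ map c p
    i∈ = occ≢0⇒∈ (map c p) (λ occ≡0 → 1+n≢0 (trans (sym occ≡1) occ≡0))
    injective : ∀ {x} → x ∈ map c p → punchOut j x ≡ punchOut j i → x ≡ i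
    injective x∈ = punchOut-injective (colour≢j x∈) (colour≢j i∈)

closed-split : ∀ {X C} → Closed X C → ∀ {p} → Linked _∼_ p → All (_∈ X) p → All (_∈ C) p ⊎ All (_∉ C) p
closed-split cl [] [] = inj₁ []
closed-split {C = C} cl [-] (x∈X ∷ []) with _ ∈? C
... | yes x∈C = inj₁ (x∈C ∷ [])
... | no x∉C  = inj₂ (x∉C ∷ [])
closed-split cl (_∷_ {x} {y} x∼y Ryp) (x∈X ∷ y∈X∷p) with closed-split cl Ryp y∈X∷p
... | inj₁ (y∈C ∷ p⊆C) = inj₁ (cl y∈C x∈X (∼-sym {x} {y} x∼y) ∷ y∈C ∷ p⊆C)
... | inj₂ (y∉C ∷ p∩C) = inj₂ ((λ x∈C → y∉C (cl x∈C (All.head y∈X∷p) x∼y)) ∷ y∉C ∷ p∩C)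

module _ (C : List Point) (v : Point) (k : ℕ) (r₁ r₂ : Point → ℕ) where

  glue : Point → ℕ
  glue q with q ∈? C | q ≟ₚ v
  ... | yes _ | yes _ = k
  ... | yes _ | no _  = r₁ q
  ... | no _  | _     = r₂ q

  glue-v : v ∈ C → glue v ≡ k
  glue-v v∈C with v ∈? C | v ≟ₚ v
  ... | yes _   | yes _   = refl
  ... | yes _   | no v≢v  = ⊥-elim (v≢v refl)
  ... | no v∉C  | _       = ⊥-elim (v∉C v∈C)

  glue-inner : ∀ {q} → q ∈ C → q ≢ v → glue q ≡ r₁ q
  glue-inner {q} q∈C q≢v with q ∈? C | q ≟ₚ v
  ... | yes _   | yes q≡v = ⊥-elim (q≢v q≡v)
  ... | yes _   | no _    = refl
  ... | no q∉C  | _       = ⊥-elim (q∉C q∈C)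

  glue-outer : ∀ {q} → q ∉ C → glue q ≡ r₂ q
  glue-outer {q} q∉C with q ∈? C
  ... | yes q∈C = ⊥-elim (q∉C q∈C)
  ... | no _    = refl

  uniqueMaximum-glue : ∀ {X} → Closed X C → v ∈ C →
    UniqueMaximum k r₁ (λ q → q ∈ X × q ∈ C × q ≢ v) →
    UniqueMaximum (suc k) r₂ (λ q → q ∈ X × q ∉ C) →
    UniqueMaximum (suc k) glue (_∈ X)
  uniqueMaximum-glue {X} closed v∈C um₁ um₂ = record { bounded = bounded ; unique-max = unique-max }
    where
    module U₁ = UniqueMaximum um₁
    module U₂ = UniqueMaximum um₂

    bounded : ∀ {q} → q ∈ X → glue q < suc k
    bounded {q} q∈X with q ∈? C | q ≟ₚ v
    ... | yes _   | yes _   = n<1+n k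
    ... | yes q∈C | no q≢v  = m<n⇒m<1+n (U₁.bounded (q∈X , q∈C , q≢v))
    ... | no q∉C  | _       = U₂.bounded (q∈X , q∉C)

    via : ∀ {p f} → map glue p ≡ map f p → occ (maxL (map f p)) (map f p) ≡ 1 →
          occ (maxL (map glue p)) (map glue p) ≡ 1
    via {p} eq = subst (λ l → occ (maxL l) l ≡ 1) (sym eq)

    unique-max : ∀ {p} → GridPath p → All (_∈ X) p → occ (maxL (map glue p)) (map glue p) ≡ 1
    unique-max {p} path p⊆X with closed-split closed (GridPath.linked path) p⊆X
    ... | inj₂ p∩C = via (map-cong-local (All.map glue-outer p∩C))
                         (U₂.unique-max path (All.zip (p⊆X , p∩C)))
    ... | inj₁ p⊆C with v ∈? p
    ...   | yes v∈p = unique-maximum glue p (GridPath.distinct path) v∈p below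
      where
      below : ∀ {q} → q ∈ p → q ≢ v → glue q < glue v
      below {q} q∈p q≢v rewrite glue-inner (All.lookup p⊆C q∈p) q≢v | glue-v v∈C =
        U₁.bounded (All.lookup p⊆X q∈p , All.lookup p⊆C q∈p , q≢v)
    ...   | no v∉p = via (map-cong-local (All.map (λ (q∈C , q≢v) → glue-inner q∈C q≢v) p⊆C∖v))
                         (U₁.unique-max path (All.zip (p⊆X , p⊆C∖v)))
      where
      p⊆C∖v : All (λ q → q ∈ C × q ≢ v) p
      p⊆C∖v = All.tabulate λ q∈p → All.lookup p⊆C q∈p , λ { refl → v∉p q∈p }

module _ {X : List Point} {v₀ : Point} (comp : Component X v₀) {k c} (cf : ConflictFree k c (BlowUp X)) where

  open Component comp
  open ConflictFree cf

  record LoneColour : Set where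
    field
      cell             : Point
      colour           : ℕ
      cell∈cells       : cell ∈ cells
      colour<k         : colour < k
      absent-elsewhere : ∀ {q} → block q ∈ cells → block q ≢ cell → c q ≢ colour

  private
    T : List Point
    T = drop 1 walk

    tour-path : GridPath T
    tour-path = record
      { nonempty = ∈⇒≢[] (Tour.complete tour (subst (_∈ cells) (sym (block-corner south v₀)) ∋v))
      ; distinct = Tour.unique tour
      ; linked   = linked-drop1 (Tour.linked tour)
      }

  lone-colour : LoneColour
  lone-colour with conflict-free tour-path (All.tabulate (⊆X ∘ Tour.sound tour))
  ... | j , occ≡1 with ∈-map⁻ c (occ≢0⇒∈ (map c T) (λ occ≡0 → 1+n≢0 (trans (sym occ≡1) occ≡0)))
  ... | t , t∈T , j≡ct = record
    { cell = block t ; colour = j ; cell∈cells = Tour.sound tour t∈T ; colour<k = j<k ; absent-elsewhere = absent }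
    where
    j<k : j < k
    j<k = subst (_< k) (sym j≡ct) (bounded (⊆X (Tour.sound tour t∈T)))
    absent : ∀ {q} → block q ∈ cells → block q ≢ block t → c q ≢ j
    absent bq∈ bq≢bt cq≡j =
      bq≢bt (cong block (occ≡1-unique c T occ≡1 (Tour.complete tour bq∈) t∈T cq≡j (sym j≡ct)))

UniqueMaximumOn : List Point → ℕ → Set
UniqueMaximumOn X k = ∃ λ r → UniqueMaximum k r (_∈ X)

module Split {X : List Point} {v₀ : Point} (comp : Component X v₀) (v : Point) where

  open Component comp

  inner? : Decidable (λ q → q ∈ cells × q ≢ v)
  inner? q = (q ∈? cells) ×-dec ¬? (q ≟ₚ v)

  inner outer : List Point
  inner = filter inner? X
  outer = filter (_∉? cells) X

  inner-shrinks : v ∈ cells → length inner < length X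
  inner-shrinks v∈C = filter-notAll inner? X (lose (⊆X v∈C) (λ (_ , v≢v) → v≢v refl))

  outer-shrinks : v₀ ∈ X → length outer < length X
  outer-shrinks v₀∈X = filter-notAll (_∉? cells) X (lose v₀∈X (λ v₀∉C → v₀∉C ∋v))

  uniqueMaximum-split : ∀ {k} → v ∈ cells → UniqueMaximumOn inner k → UniqueMaximumOn outer (suc k) →
    UniqueMaximumOn X (suc k)
  uniqueMaximum-split {k} v∈C (r₁ , um₁) (r₂ , um₂) = glue cells v k r₁ r₂ ,
    uniqueMaximum-glue cells v k r₁ r₂ closed v∈C
      (uniqueMaximum-⊆ (λ (q∈X , q∈C , q≢v) → ∈-filter⁺ inner? q∈X (q∈C , q≢v)) um₁)
      (uniqueMaximum-⊆ (λ (q∈X , q∉C) → ∈-filter⁺ (_∉? cells) q∈X q∉C) um₂)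

cf⇒um-acc : ∀ X → Acc _<_ (length X) → ∀ {k c} → ConflictFree k c (BlowUp X) → UniqueMaximumOn X k
cf⇒um-acc [] _ _ = (λ _ → 0) , record
  { bounded    = λ ()
  ; unique-max = λ { path [] → ⊥-elim (GridPath.nonempty path refl) ; _ (() ∷ _) }
  }
cf⇒um-acc (v₀ ∷ _) _ {zero} cf =
  ⊥-elim (n≮0 (ConflictFree.bounded cf {corner south v₀} (here (block-corner south v₀))))
cf⇒um-acc X@(v₀ ∷ _) (acc rs) {suc k} {c} cf = uniqueMaximum-split cell∈cells
  (cf⇒um-acc inner (rs (inner-shrinks cell∈cells))
     (conflictFree-punchOut absent-inner colour<k (conflictFree-⊆ inner⊆X cf)))
  (cf⇒um-acc outer (rs (outer-shrinks (here refl))) (conflictFree-⊆ outer⊆X cf))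
  where
  comp : Component X v₀
  comp = component (here refl)
  open Component comp using (cells)
  open LoneColour (lone-colour comp cf)
  open Split comp cell
  inner⊆X : BlowUp inner ⊆ BlowUp X
  inner⊆X = proj₁ ∘ ∈-filter⁻ inner?
  outer⊆X : BlowUp outer ⊆ BlowUp X
  outer⊆X = proj₁ ∘ ∈-filter⁻ (_∉? cells)
  absent-inner : ∀ {q} → BlowUp inner q → c q ≢ colour
  absent-inner bq∈ = let _ , bq∈C , bq≢v = ∈-filter⁻ inner? bq∈ in absent-elsewhere bq∈C bq≢v

cf⇒um : ∀ X {k c} → ConflictFree k c (BlowUp X) → UniqueMaximumOn X k
cf⇒um X = cf⇒um-acc X (<-wellFounded (length X))

grid : ℕ → List Point
grid n = cartesianProduct (upTo n) (upTo n)

∈-grid⁺ : ∀ {n a b} → a < n → b < n → (a , b) ∈ grid n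
∈-grid⁺ a<n b<n = ∈-cartesianProduct⁺ (∈-upTo⁺ a<n) (∈-upTo⁺ b<n)

∈-grid⁻ : ∀ {n a b} → (a , b) ∈ grid n → a < n × b < n
∈-grid⁻ {n} ab∈ with ∈-cartesianProduct⁻ (upTo n) (upTo n) ab∈
... | a∈ , b∈ = ∈-upTo⁻ a∈ , ∈-upTo⁻ b∈

double≡*2 : ∀ n → double n ≡ n * 2
double≡*2 zero    = refl
double≡*2 (suc n) = cong (suc ∘ suc) (double≡*2 n)

≤1+double⌊/2⌋ : ∀ x → x ≤ suc (double ⌊ x /2⌋)
≤1+double⌊/2⌋ zero          = z≤n
≤1+double⌊/2⌋ (suc zero)    = s≤s z≤n
≤1+double⌊/2⌋ (suc (suc x)) = s≤s (s≤s (≤1+double⌊/2⌋ x))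

⌊/2⌋<⇒< : ∀ m x → ⌊ x /2⌋ < m / 2 → x < m
⌊/2⌋<⇒< m x h = begin-strict
  x                          <⟨ s≤s (≤1+double⌊/2⌋ x) ⟩
  double (suc ⌊ x /2⌋)       ≡⟨ double≡*2 (suc ⌊ x /2⌋) ⟩
  suc ⌊ x /2⌋ * 2            ≤⟨ *-monoˡ-≤ 2 h ⟩
  m / 2 * 2                  ≤⟨ m/n*n≤m m 2 ⟩
  m                          ∎
  where open ≤-Reasoning

module _ (m : ℕ) .{{_ : NonZero m}} where

  -- Reducing the coordinates mod m is the identity on the points where this map is used.
  toVertex : Point → Vertex m
  toVertex (x , y) = fromℕ< (m%n<n x m) , fromℕ< (m%n<n y m)

  toℕ-fromℕ<-% : ∀ {x} → x < m → toℕ (fromℕ< (m%n<n x m)) ≡ x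
  toℕ-fromℕ<-% x<m = trans (toℕ-fromℕ< (m%n<n _ m)) (m<n⇒m%n≡m x<m)

  InGrid : Point → Set
  InGrid (x , y) = x < m × y < m

  toVertex-injective : ∀ {p q} → InGrid p → InGrid q → toVertex p ≡ toVertex q → p ≡ q
  toVertex-injective {x , y} {x′ , y′} (x<m , y<m) (x′<m , y′<m) e = cong₂ _,_
    (trans (sym (toℕ-fromℕ<-% x<m)) (trans (cong (toℕ ∘ proj₁) e) (toℕ-fromℕ<-% x′<m)))
    (trans (sym (toℕ-fromℕ<-% y<m)) (trans (cong (toℕ ∘ proj₂) e) (toℕ-fromℕ<-% y′<m)))

  toVertex-adjacent : ∀ {p q} → InGrid p → InGrid q → p ∼ q → Adj (toVertex p) (toVertex q)
  toVertex-adjacent {x , y} {x′ , y′} (x<m , y<m) (x′<m , y′<m) p∼q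
    rewrite toℕ-fromℕ<-% x<m | toℕ-fromℕ<-% y<m | toℕ-fromℕ<-% x′<m | toℕ-fromℕ<-% y′<m = p∼q

  toVertex-path : ∀ {p} → GridPath p → All InGrid p → IsPath (map toVertex p)
  toVertex-path {p} path p⊆grid = record
    { nonempty = map-≢[] (GridPath.nonempty path)
    ; distinct = distinct p⊆grid (GridPath.distinct path)
    ; linked   = linked p⊆grid (GridPath.linked path)
    }
    where
    distinct : ∀ {p} → All InGrid p → Unique p → Unique (map toVertex p)
    distinct []          []          = []
    distinct (gx ∷ gp) (x∉p ∷ up) =
      All.map⁺ (All.zipWith (λ (gy , x≢y) → x≢y ∘ toVertex-injective gx gy) (gp , x∉p)) ∷ distinct gp up
    linked : ∀ {p} → All InGrid p → Linked _∼_ p → Linked Adj (map toVertex p)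
    linked _               []          = []
    linked _               [-]         = [-]
    linked (gx ∷ gy ∷ gp) (x∼y ∷ Rp) = toVertex-adjacent gx gy x∼y ∷ linked (gy ∷ gp) Rp

fromVertex : ∀ {n} → Vertex n → Point
fromVertex (i , j) = toℕ i , toℕ j

fromVertex-injective : ∀ {n} {u v : Vertex n} → fromVertex u ≡ fromVertex v → u ≡ v
fromVertex-injective e = cong₂ _,_ (toℕ-injective (cong proj₁ e)) (toℕ-injective (cong proj₂ e))

fromVertex-path : ∀ {n} {p : List (Vertex n)} → IsPath p → GridPath (map fromVertex p)
fromVertex-path path = record
  { nonempty = map-≢[] (IsPath.nonempty path)
  ; distinct = Unique.map⁺ fromVertex-injective (IsPath.distinct path)
  ; linked   = Linked.map⁺ (IsPath.linked path)
  }

fromVertex∈grid : ∀ {n} (v : Vertex n) → fromVertex v ∈ grid n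
fromVertex∈grid (i , j) = ∈-grid⁺ (toℕ<n i) (toℕ<n j)

cf⇒um-halved : ∀ m .{{_ : NonZero m}} a → HasCFColoring m a → HasUMColoring (m / 2) a
cf⇒um-halved m a (c , isCF) = c′ , isUM
  where
  n : ℕ
  n = m / 2

  colour : Point → ℕ
  colour q = toℕ (c (toVertex m q))

  blowUp⊆grid : ∀ {q} → BlowUp (grid n) q → InGrid m q
  blowUp⊆grid {x , y} bq∈ with ∈-grid⁻ bq∈
  ... | x<n , y<n = ⌊/2⌋<⇒< m x x<n , ⌊/2⌋<⇒< m y y<n

  cf : ConflictFree a colour (BlowUp (grid n))
  cf = record { bounded = λ _ → toℕ<n _ ; conflict-free = conflict-free }
    where
    conflict-free : ∀ {p} → GridPath p → All (BlowUp (grid n)) p → ∃[ j ] occ j (map colour p) ≡ 1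
    conflict-free {p} path p⊆ with isCF (map (toVertex m) p) (toVertex-path m path (All.map blowUp⊆grid p⊆))
    ... | j , occ≡1 = toℕ j , trans (cong (occ (toℕ j)) (map-∘ p)) occ≡1

  r : Point → ℕ
  r = proj₁ (cf⇒um (grid n) cf)

  um : UniqueMaximum a r (_∈ grid n)
  um = proj₂ (cf⇒um (grid n) cf)

  c′ : Coloring n a
  c′ v = fromℕ< (UniqueMaximum.bounded um (fromVertex∈grid v))

  colorsOn-c′ : ∀ p → colorsOn c′ p ≡ map r (map fromVertex p)
  colorsOn-c′ p = trans (map-cong-local (All.tabulate λ {v} _ → toℕ-fromℕ< _)) (map-∘ p)

  isUM : IsUMColoring c′
  isUM p path = subst (λ l → occ (maxL l) l ≡ 1) (sym (colorsOn-c′ p))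
    (UniqueMaximum.unique-max um (fromVertex-path path) (All.map⁺ (All.tabulate λ {v} _ → fromVertex∈grid v)))

theorem3 : ∀ (m : ℕ) → 1 < m → ∀ (a b : ℕ) →
    IsChiCF m a → IsChiUM (m / 2) b → b ≤ a
theorem3 m@(suc _) _ a b (hasCF , _) (_ , minimal) = ≮⇒≥ (λ a<b → minimal a a<b (cf⇒um-halved m a hasCF))
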